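{- Let $F$ be an isonemal fabric whose warp and weft stripes (single strands for thin striping, adjacent pairs for thick striping) are coloured with a finite number of colours. If this colouring is perfect, then the sequence of colours of the vertical stripes (read left to right) and the sequence of colours of the horizontal stripes (read bottom to top) are periodic with the same period.
   Context: Cells are unit squares tessellating the plane; vertical strips are warps, horizontal strips are wefts. A prefabric assigns to each cell which crossing strand is on top; a fabric does not fall apart. With $\tau$ reflection in the plane of the fabric, the symmetry group $G_1$ consists of pairs $(t,r)$, $t$ a plane isometry preserving the cell tessellation and $r\in\{e,\tau\}$, with $t$ mapping the over/under relation to itself ($r=e$) or its reverse ($r=\tau$). Isonemal: periodic with $G_1$ transitive on all strands. Thin striping colours each strand; thick striping colours adjacent pairs of strands $[2a,2a+2]$. An element $(t,r)\in G_1$ is a colour symmetry if for each colour, $t$ maps all strands of that colour onto strands of one common colour; the colouring is perfect if every element of $G_1$ is a colour symmetry. -}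

module Defs where

open import Data.Bool using (Bool; true; false)
open import Data.Nat as ℕ using (ℕ)
open import Data.Integer using (ℤ; +_; -_; _+_; _-_; _*_; _/ℕ_; 0ℤ; _<_)
open import Data.Fin using (Fin)
open import Data.Product using (_×_; _,_; Σ; ∃; ∃-syntax)
open import Data.Unit using (⊤)
open import Data.Empty using (⊥)
open import Relation.Binary.PropositionalEquality using (_≡_; _≢_)
open import Relation.Nullary using (¬_)
open import Function.Bundles using (_⇔_)

-- Cells and strands
-- Cell (i , j) is the unit square [i,i+1] × [j,j+1].
-- Warp i is the vertical strip (column) of cells (i , _);
-- weft j is the horizontal strip (row) of cells (_ , j).
-- Warp i and weft j cross exactly at cell (i , j).

Cell : Set
Cell = ℤ × ℤ

data Strand : Set where
  warp : ℤ → Strand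
  weft : ℤ → Strand

Cross : Strand → Strand → Set
Cross (warp _) (weft _) = ⊤
Cross (weft _) (warp _) = ⊤
Cross (warp _) (warp _) = ⊥
Cross (weft _) (weft _) = ⊥

-- A prefabric: for each cell, which crossing strand is on top.
-- true = the warp is on top, false = the weft is on top.
Prefabric : Set
Prefabric = Cell → Bool

Over : Prefabric → Strand → Strand → Set
Over F (warp i) (weft j) = F (i , j) ≡ true
Over F (weft j) (warp i) = F (i , j) ≡ false
Over F (warp _) (warp _) = ⊥
Over F (weft _) (weft _) = ⊥

FallsApart : Prefabric → Set
FallsApart F =
  Σ (Strand → Bool) λ S →
    (∃[ s ] S s ≡ true) × (∃[ s ] S s ≡ false) ×
    (∀ s s' → S s ≡ true → S s' ≡ false → Cross s s' → Over F s s')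

IsFabric : Prefabric → Set
IsFabric F = ¬ FallsApart F

-- Isometries of the plane preserving the cell tessellation.
-- Every such isometry is x ↦ A x + b with A one of the 8 signed permutation
-- matrices and b such that cells go to cells; its action on cells is
--   no swap : (i , j) ↦ (σ₁ i + c₁ , σ₂ j + c₂)
--   swap    : (i , j) ↦ (σ₁ j + c₁ , σ₂ i + c₂)
-- with σ₁, σ₂ ∈ {+1, -1} and c₁, c₂ ∈ ℤ, and this correspondence is bijective.

sgn : Bool → ℤ → ℤ
sgn false x = x
sgn true  x = - x

record Isometry : Set where
  constructor iso
  field
    swap : Bool
    neg₁ : Bool
    neg₂ : Bool
    c₁   : ℤ
    c₂   : ℤ

cellMap : Isometry → Cell → Cell
cellMap (iso false n₁ n₂ c₁ c₂) (i , j) = (sgn n₁ i + c₁ , sgn n₂ j + c₂)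
cellMap (iso true  n₁ n₂ c₁ c₂) (i , j) = (sgn n₁ j + c₁ , sgn n₂ i + c₂)

strandMap : Isometry → Strand → Strand
strandMap (iso false n₁ n₂ c₁ c₂) (warp i) = warp (sgn n₁ i + c₁)
strandMap (iso false n₁ n₂ c₁ c₂) (weft j) = weft (sgn n₂ j + c₂)
strandMap (iso true  n₁ n₂ c₁ c₂) (warp i) = weft (sgn n₂ i + c₂)
strandMap (iso true  n₁ n₂ c₁ c₂) (weft j) = warp (sgn n₁ j + c₁)

translation : ℤ → ℤ → Isometry
translation a b = iso false false false a b

data Refl : Set where
  e τ : Refl

InG₁ : Prefabric → Isometry → Refl → Set
InG₁ F t e = ∀ s s' → Over F s s' ⇔ Over F (strandMap t s) (strandMap t s')
InG₁ F t τ = ∀ s s' → Over F s s' ⇔ Over F (strandMap t s') (strandMap t s)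

Periodic : Prefabric → Set
Periodic F =
  ∃[ a ] ∃[ b ] ∃[ c ] ∃[ d ]
    (a * d - b * c ≢ 0ℤ) ×
    InG₁ F (translation a b) e × InG₁ F (translation c d) e

Isonemal : Prefabric → Set
Isonemal F =
  Periodic F ×
  (∀ s s' → ∃[ t ] ∃[ r ] (InG₁ F t r × strandMap t s ≡ s'))

-- Striping.  Thin striping: each stripe is a single strand.
-- Thick striping: stripe a consists of the two adjacent strands 2a, 2a+1
-- (the strip [2a, 2a+2]).

data Striping : Set where
  thin thick : Striping

width : Striping → ℕ
width thin  = 1
width thick = 2

stripeOf : Striping → ℤ → ℤ
stripeOf thin  i = i /ℕ 1
stripeOf thick i = i /ℕ 2

strandColour : ∀ {k} → Striping → (ℤ → Fin k) → (ℤ → Fin k) → Strand → Fin k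
strandColour σ V H (warp i) = V (stripeOf σ i)
strandColour σ V H (weft j) = H (stripeOf σ j)

IsColourSymmetry : ∀ {k} → (Strand → Fin k) → Isometry → Set
IsColourSymmetry {k} col t =
  ∀ (c : Fin k) → ∃[ c' ] (∀ s → col s ≡ c → col (strandMap t s) ≡ c')

IsPerfect : ∀ {k} → Prefabric → (Strand → Fin k) → Set
IsPerfect F col = ∀ t r → InG₁ F t r → IsColourSymmetry col t

HasPeriod : ∀ {A : Set} → (ℤ → A) → ℕ → Set
HasPeriod f p = ∀ i → f (i + + p) ≡ f i

IsPeriodOf : ∀ {A : Set} → (ℤ → A) → ℕ → Set
IsPeriodOf f p =
  (0 ℕ.< p) × HasPeriod f p × (∀ q → 0 ℕ.< q → q ℕ.< p → ¬ HasPeriod f q)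

-- A translation symmetry (t , e) whose horizontal component a is nonzero acts on
-- the k colours by some map g, so the colour of warp i + n·a is gⁿ applied to the
-- colour of warp i.  Every map g on k points satisfies g^(k + k!) = g^k, hence the
-- warp colours, and with them V, are periodic.  Transitivity on strands provides a
-- symmetry exchanging warps and wefts; as a colour symmetry it conjugates the warp
-- colours to the weft colours along an isometry of ℤ, so V and H have exactly the
-- same periods and therefore the same least period.
module Submission where

open import Data.Bool using (true; false)
open import Data.Empty using (⊥-elim)
open import Data.Fin as Fin using (Fin; toℕ)
import Data.Fin.Properties as Fin
open import Data.Integer as ℤ
  using (ℤ; +_; -[1+_]; -_; _+_; _-_; _*_; _/ℕ_; _%ℕ_; 0ℤ; _≤_; _<_; +<+)
  renaming (suc to sucℤ)
open import Data.Integer.DivMod using (a≡a%ℕn+[a/ℕn]*n; n%ℕd<d; [n/ℕd]*d≤n; n<s[n/ℕd]*d)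
open import Data.Integer.Properties
open import Data.Integer.Tactic.RingSolver using (solve-∀)
open import Data.Nat as ℕ using (ℕ; zero; suc; _!; NonZero)
open import Data.Nat.Divisibility using (_∣_; divides; ∣-trans; m∣m*n; m≤n⇒m!∣n!)
open import Data.Nat.Induction using (<-rec)
import Data.Nat.Properties as ℕ
open import Data.Product using (_×_; _,_; ∃-syntax; proj₁; proj₂)
import Function.Endo.Propositional as Endo
open import Function.Base using (_∘_)
open import Function.Bundles using (_⇔_; mk⇔; Equivalence)
open import Relation.Binary.Definitions using (DecidableEquality)
open import Relation.Binary.PropositionalEquality
open import Relation.Nullary using (¬_; yes; no)
open import Relation.Nullary.Decidable using (map′; _×-dec_)
open import Relation.Unary using (Decidable)

open import Defs

open Equivalence using (to; from)

module _ {d : ℕ} .{{_ : NonZero d}} where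

  q*d≤n<[1+q′]*d⇒q≤q′ : ∀ {n q q′} → q * + d ≤ n → n < sucℤ q′ * + d → q ≤ q′
  q*d≤n<[1+q′]*d⇒q≤q′ q*d≤n n<[1+q′]*d = ≮⇒≥ λ q′<q → <-irrefl refl
    (<-≤-trans n<[1+q′]*d (≤-trans (*-monoʳ-≤-nonNeg (+ d) (i<j⇒suc[i]≤j q′<q)) q*d≤n))

  /ℕ-unique : ∀ {n q r} → r ℕ.< d → n ≡ + r + q * + d → n /ℕ d ≡ q
  /ℕ-unique {q = q} {r} r<d refl = ≤-antisym
    (q*d≤n<[1+q′]*d⇒q≤q′ ([n/ℕd]*d≤n _ d) n<[1+q]*d)
    (q*d≤n<[1+q′]*d⇒q≤q′ (i≤j+i (q * + d) (+ r)) (n<s[n/ℕd]*d _ d))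
    where
    n<[1+q]*d : + r + q * + d < sucℤ q * + d
    n<[1+q]*d = begin-strict
      + r + q * + d  <⟨ +-monoˡ-< (q * + d) (+<+ r<d) ⟩
      + d + q * + d  ≡⟨ suc-* q (+ d) ⟨
      sucℤ q * + d   ∎
      where open ≤-Reasoning

  [n+m*d]/ℕd≡n/ℕd+m : ∀ n m → (n + m * + d) /ℕ d ≡ n /ℕ d + m
  [n+m*d]/ℕd≡n/ℕd+m n m = /ℕ-unique (n%ℕd<d n d) (begin
    n + m * + d                      ≡⟨ cong (_+ m * + d) (a≡a%ℕn+[a/ℕn]*n n d) ⟩
    + r + q * + d + m * + d          ≡⟨ +-assoc (+ r) (q * + d) (m * + d) ⟩
    + r + (q * + d + m * + d)        ≡⟨ cong (_+_ (+ r)) (*-distribʳ-+ (+ d) q m) ⟨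
    + r + (q + m) * + d              ∎)
    where
    open ≡-Reasoning
    r : ℕ
    r = n %ℕ d
    q : ℤ
    q = n /ℕ d

  [m*d]/ℕd≡m : ∀ m → (m * + d) /ℕ d ≡ m
  [m*d]/ℕd≡m m = /ℕ-unique (ℕ.>-nonZero⁻¹ d) (sym (+-identityˡ (m * + d)))

-- HasPeriod f p is definitionally HasIntPeriod f (+ p).
HasIntPeriod : ∀ {A : Set} → (ℤ → A) → ℤ → Set
HasIntPeriod f t = ∀ i → f (i + t) ≡ f i

module _ {A : Set} {f : ℤ → A} where

  HasIntPeriod-+ : ∀ {t u} → HasIntPeriod f t → HasIntPeriod f u → HasIntPeriod f (t + u)
  HasIntPeriod-+ {t} {u} ht hu i =
    trans (cong f (sym (+-assoc i t u))) (trans (hu (i + t)) (ht i))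

  HasIntPeriod-neg : ∀ {t} → HasIntPeriod f t → HasIntPeriod f (- t)
  HasIntPeriod-neg {t} ht i = trans (sym (ht (i - t))) (cong f (i-t+t≡i i t))
    where
    i-t+t≡i : ∀ i t → i - t + t ≡ i
    i-t+t≡i = solve-∀

  HasIntPeriod-*ℕ : ∀ {t} → HasIntPeriod f t → ∀ m → HasIntPeriod f (+ m * t)
  HasIntPeriod-*ℕ {t} ht zero    i =
    cong f (trans (cong (_+_ i) (*-zeroˡ t)) (+-identityʳ i))
  HasIntPeriod-*ℕ {t} ht (suc m) =
    subst (HasIntPeriod f) (sym (suc-* (+ m) t)) (HasIntPeriod-+ ht (HasIntPeriod-*ℕ ht m))

  HasIntPeriod-* : ∀ {t} → HasIntPeriod f t → ∀ m → HasIntPeriod f (m * t)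
  HasIntPeriod-* ht (+ m)    = HasIntPeriod-*ℕ ht m
  HasIntPeriod-* {t} ht -[1+ m ] =
    subst (HasIntPeriod f) (neg-distribˡ-* (+ suc m) t)
      (HasIntPeriod-neg (HasIntPeriod-*ℕ ht (suc m)))

  HasIntPeriod⇒HasPeriod-∣∣ : ∀ {t} → HasIntPeriod f t → HasPeriod f ℤ.∣ t ∣
  HasIntPeriod⇒HasPeriod-∣∣ {+ n}    ht = ht
  HasIntPeriod⇒HasPeriod-∣∣ { -[1+ n ]} ht = HasIntPeriod-neg ht

  HasPeriod-*ℕ : ∀ {p} → HasPeriod f p → ∀ m → HasPeriod f (m ℕ.* p)
  HasPeriod-*ℕ {p} hp m = subst (HasIntPeriod f) (sym (pos-* m p)) (HasIntPeriod-*ℕ hp m)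

  HasIntPeriod-sgn : ∀ {t} n → HasIntPeriod f t → HasIntPeriod f (sgn n t)
  HasIntPeriod-sgn false ht = ht
  HasIntPeriod-sgn true  ht = HasIntPeriod-neg ht

sgn-involutive : ∀ n i → sgn n (sgn n i) ≡ i
sgn-involutive false i = refl
sgn-involutive true  i = neg-involutive i

sgn-distrib-+ : ∀ n i j → sgn n (i + j) ≡ sgn n i + sgn n j
sgn-distrib-+ false i j = refl
sgn-distrib-+ true  i j = neg-distrib-+ i j

HasIntPeriod-transport : ∀ {A B : Set} {X : ℤ → A} {Y : ℤ → B} {t} (g : B → A) n c →
                         (∀ i → X (sgn n i + c) ≡ g (Y i)) →
                         HasIntPeriod Y t → HasIntPeriod X t
HasIntPeriod-transport {X = X} {Y} {t} g n c X∘φ≡g∘Y hY j = begin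
  X (j + t)                   ≡⟨ cong X (φ∘ψ (j + t)) ⟨
  X (sgn n (ψ (j + t)) + c)   ≡⟨ X∘φ≡g∘Y (ψ (j + t)) ⟩
  g (Y (ψ (j + t)))           ≡⟨ cong (g ∘ Y) ψ[j+t]≡ψ[j]+sgn[t] ⟩
  g (Y (ψ j + sgn n t))       ≡⟨ cong g (HasIntPeriod-sgn n hY (ψ j)) ⟩
  g (Y (ψ j))                 ≡⟨ X∘φ≡g∘Y (ψ j) ⟨
  X (sgn n (ψ j) + c)         ≡⟨ cong X (φ∘ψ j) ⟩
  X j                         ∎
  where
  open ≡-Reasoning
  ψ : ℤ → ℤ
  ψ i = sgn n (i - c)
  i-c+c≡i : ∀ i c → i - c + c ≡ i
  i-c+c≡i = solve-∀
  i+t-c≡i-c+t : ∀ i t c → i + t - c ≡ i - c + t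
  i+t-c≡i-c+t = solve-∀
  φ∘ψ : ∀ i → sgn n (ψ i) + c ≡ i
  φ∘ψ i = trans (cong (_+ c) (sgn-involutive n (i - c))) (i-c+c≡i i c)
  ψ[j+t]≡ψ[j]+sgn[t] : ψ (j + t) ≡ ψ j + sgn n t
  ψ[j+t]≡ψ[j]+sgn[t] = trans (cong (sgn n) (i+t-c≡i-c+t j t c)) (sgn-distrib-+ n (j - c) t)

HasPeriod-∘/ℕ : ∀ {A : Set} d .{{_ : NonZero d}} (U : ℤ → A) p →
                HasPeriod U p ⇔ HasPeriod (λ i → U (i /ℕ d)) (d ℕ.* p)
HasPeriod-∘/ℕ d U p = mk⇔ scale-up scale-down
  where
  open ≡-Reasoning
  d*p≡p*d : + (d ℕ.* p) ≡ + p * + d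
  d*p≡p*d = trans (pos-* d p) (*-comm (+ d) (+ p))

  scale-up : HasPeriod U p → HasPeriod (λ i → U (i /ℕ d)) (d ℕ.* p)
  scale-up hp i = begin
    U ((i + + (d ℕ.* p)) /ℕ d)  ≡⟨ cong (λ x → U ((i + x) /ℕ d)) d*p≡p*d ⟩
    U ((i + + p * + d) /ℕ d)    ≡⟨ cong U ([n+m*d]/ℕd≡n/ℕd+m i (+ p)) ⟩
    U (i /ℕ d + + p)            ≡⟨ hp (i /ℕ d) ⟩
    U (i /ℕ d)                  ∎

  scale-down : HasPeriod (λ i → U (i /ℕ d)) (d ℕ.* p) → HasPeriod U p
  scale-down hdp s = begin
    U (s + + p)                         ≡⟨ cong U ([m*d]/ℕd≡m (s + + p)) ⟨
    U (((s + + p) * + d) /ℕ d)          ≡⟨ cong (λ x → U (x /ℕ d)) [s+p]*d≡s*d+d*p ⟩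
    U ((s * + d + + (d ℕ.* p)) /ℕ d)    ≡⟨ hdp (s * + d) ⟩
    U ((s * + d) /ℕ d)                  ≡⟨ cong U ([m*d]/ℕd≡m s) ⟩
    U s                                 ∎
    where
    [s+p]*d≡s*d+d*p : (s + + p) * + d ≡ s * + d + + (d ℕ.* p)
    [s+p]*d≡s*d+d*p = trans (*-distribʳ-+ (+ d) s (+ p)) (cong (_+_ (s * + d)) (sym d*p≡p*d))

HasPeriod-stripes : ∀ {A : Set} σ (U : ℤ → A) p →
                    HasPeriod U p ⇔ HasPeriod (λ i → U (stripeOf σ i)) (width σ ℕ.* p)
HasPeriod-stripes thin  = HasPeriod-∘/ℕ 1
HasPeriod-stripes thick = HasPeriod-∘/ℕ 2

IsPeriodOf-cong : ∀ {A B : Set} {f : ℤ → A} {g : ℤ → B} {p} →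
                  (∀ q → HasPeriod f q ⇔ HasPeriod g q) → IsPeriodOf f p → IsPeriodOf g p
IsPeriodOf-cong f≈g (0<p , hp , minimal) =
  0<p , to (f≈g _) hp , λ q 0<q q<p hq → minimal q 0<q q<p (from (f≈g q) hq)

minimal-witness : ∀ {P : ℕ → Set} → Decidable P → ∀ {n} → P n →
                  ∃[ m ] (P m × (∀ {j} → j ℕ.< m → ¬ P j))
minimal-witness {P} P? {n} = <-rec Goal step n
  where
  Goal : ℕ → Set
  Goal n = P n → ∃[ m ] (P m × (∀ {j} → j ℕ.< m → ¬ P j))
  step : ∀ n → (∀ {m} → m ℕ.< n → Goal m) → Goal n
  step n smaller pn with ℕ.anyUpTo? P? n
  ... | yes (m , m<n , pm) = smaller m<n pm
  ... | no none            = n , pn , λ j<n pj → none (_ , j<n , pj)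

module _ {A : Set} (_≟_ : DecidableEquality A) {f : ℤ → A} {P : ℕ} .{{_ : NonZero P}}
         (hP : HasPeriod f P) where

  HasPeriod-fromResidues : ∀ {q} → (∀ {r} → r ℕ.< P → f (+ r + + q) ≡ f (+ r)) → HasPeriod f q
  HasPeriod-fromResidues {q} onResidues i = begin
    f (i + + q)                 ≡⟨ cong f i+q≡r+q+m*P ⟩
    f (+ r + + q + m * + P)     ≡⟨ HasIntPeriod-* hP m (+ r + + q) ⟩
    f (+ r + + q)               ≡⟨ onResidues (n%ℕd<d i P) ⟩
    f (+ r)                     ≡⟨ HasIntPeriod-* hP m (+ r) ⟨
    f (+ r + m * + P)           ≡⟨ cong f (a≡a%ℕn+[a/ℕn]*n i P) ⟨
    f i                         ∎
    where
    open ≡-Reasoning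
    r : ℕ
    r = i %ℕ P
    m : ℤ
    m = i /ℕ P
    r+m*P+q≡r+q+m*P : ∀ r m P q → r + m * P + q ≡ r + q + m * P
    r+m*P+q≡r+q+m*P = solve-∀
    i+q≡r+q+m*P : i + + q ≡ + r + + q + m * + P
    i+q≡r+q+m*P =
      trans (cong (_+ + q) (a≡a%ℕn+[a/ℕn]*n i P)) (r+m*P+q≡r+q+m*P (+ r) m (+ P) (+ q))

  HasPeriod? : Decidable (HasPeriod f)
  HasPeriod? q = map′ HasPeriod-fromResidues (λ hq _ → hq _)
    (ℕ.allUpTo? (λ r → f (+ r + + q) ≟ f (+ r)) P)

  leastPeriod : ∃[ p ] IsPeriodOf f p
  leastPeriod with minimal-witness (λ q → (0 ℕ.<? q) ×-dec HasPeriod? q) (ℕ.>-nonZero⁻¹ P , hP)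
  ... | p , (0<p , hp) , below = p , 0<p , hp , λ q 0<q q<p hq → below q<p (0<q , hq)

n≤m⇒n∣m! : ∀ {n m} → 0 ℕ.< n → n ℕ.≤ m → n ∣ m !
n≤m⇒n∣m! {suc n} _ n≤m = ∣-trans (m∣m*n (n !)) (m≤n⇒m!∣n! n≤m)

module _ {k : ℕ} (g : Fin k → Fin k) where

  open Endo (Fin k) using (_^_; ^-homo)

  ^-+ : ∀ m n x → (g ^ (m ℕ.+ n)) x ≡ (g ^ m) ((g ^ n) x)
  ^-+ m n x = cong-app (^-homo g m n) x

  module _ {x : Fin k} {i d : ℕ} (cycle : (g ^ (i ℕ.+ d)) x ≡ (g ^ i) x) where

    ^-cycle-step : ∀ {n} → i ℕ.≤ n → (g ^ (n ℕ.+ d)) x ≡ (g ^ n) x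
    ^-cycle-step {n} i≤n = begin
      (g ^ (n ℕ.+ d)) x                    ≡⟨ cong (λ l → (g ^ l) x) n+d≡[n∸i]+[i+d] ⟩
      (g ^ ((n ℕ.∸ i) ℕ.+ (i ℕ.+ d))) x    ≡⟨ ^-+ (n ℕ.∸ i) (i ℕ.+ d) x ⟩
      (g ^ (n ℕ.∸ i)) ((g ^ (i ℕ.+ d)) x)  ≡⟨ cong (g ^ (n ℕ.∸ i)) cycle ⟩
      (g ^ (n ℕ.∸ i)) ((g ^ i) x)          ≡⟨ ^-+ (n ℕ.∸ i) i x ⟨
      (g ^ ((n ℕ.∸ i) ℕ.+ i)) x            ≡⟨ cong (λ l → (g ^ l) x) (ℕ.m∸n+n≡m i≤n) ⟩
      (g ^ n) x                            ∎
      where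
      open ≡-Reasoning
      n+d≡[n∸i]+[i+d] : n ℕ.+ d ≡ (n ℕ.∸ i) ℕ.+ (i ℕ.+ d)
      n+d≡[n∸i]+[i+d] =
        trans (cong (ℕ._+ d) (sym (ℕ.m∸n+n≡m i≤n))) (ℕ.+-assoc (n ℕ.∸ i) i d)

    ^-cycle : ∀ {n} → i ℕ.≤ n → ∀ m → (g ^ (n ℕ.+ m ℕ.* d)) x ≡ (g ^ n) x
    ^-cycle {n} i≤n zero    = cong (λ l → (g ^ l) x) (ℕ.+-identityʳ n)
    ^-cycle {n} i≤n (suc m) = begin
      (g ^ (n ℕ.+ (d ℕ.+ m ℕ.* d))) x  ≡⟨ cong (λ l → (g ^ l) x) n+[d+md]≡n+md+d ⟩
      (g ^ (n ℕ.+ m ℕ.* d ℕ.+ d)) x    ≡⟨ ^-cycle-step (ℕ.≤-trans i≤n (ℕ.m≤m+n n (m ℕ.* d))) ⟩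
      (g ^ (n ℕ.+ m ℕ.* d)) x          ≡⟨ ^-cycle i≤n m ⟩
      (g ^ n) x                        ∎
      where
      open ≡-Reasoning
      n+[d+md]≡n+md+d : n ℕ.+ (d ℕ.+ m ℕ.* d) ≡ n ℕ.+ m ℕ.* d ℕ.+ d
      n+[d+md]≡n+md+d =
        trans (cong (ℕ._+_ n) (ℕ.+-comm d (m ℕ.* d))) (sym (ℕ.+-assoc n (m ℕ.* d) d))

  ^-repeat⇒^-[k+k!]≡^k : ∀ {x i j} → i ℕ.< j → j ℕ.≤ k → (g ^ j) x ≡ (g ^ i) x →
                         (g ^ (k ℕ.+ k !)) x ≡ (g ^ k) x
  ^-repeat⇒^-[k+k!]≡^k {x} {i} {j} i<j j≤k gʲx≡gⁱx
    with n≤m⇒n∣m! (ℕ.m<n⇒0<n∸m i<j) (ℕ.≤-trans (ℕ.m∸n≤m j i) j≤k)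
  ... | divides q k!≡q*[j∸i] = begin
    (g ^ (k ℕ.+ k !)) x                ≡⟨ cong (λ l → (g ^ (k ℕ.+ l)) x) k!≡q*[j∸i] ⟩
    (g ^ (k ℕ.+ q ℕ.* (j ℕ.∸ i))) x    ≡⟨ ^-cycle cycle (ℕ.≤-trans (ℕ.<⇒≤ i<j) j≤k) q ⟩
    (g ^ k) x                          ∎
    where
    open ≡-Reasoning
    cycle : (g ^ (i ℕ.+ (j ℕ.∸ i))) x ≡ (g ^ i) x
    cycle = trans (cong (λ l → (g ^ l) x) (ℕ.m+[n∸m]≡n (ℕ.<⇒≤ i<j))) gʲx≡gⁱx

  ^-[k+k!]≡^k : ∀ x → (g ^ (k ℕ.+ k !)) x ≡ (g ^ k) x
  ^-[k+k!]≡^k x with Fin.pigeonhole (ℕ.n<1+n k) (λ (a : Fin (suc k)) → (g ^ toℕ a) x)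
  ... | a , b , a<b , gᵃx≡gᵇx =
    ^-repeat⇒^-[k+k!]≡^k a<b (ℕ.≤-pred (Fin.toℕ<n b)) (sym gᵃx≡gᵇx)

  module _ {W : ℤ → Fin k} {a : ℤ} (W∘+a≡g∘W : ∀ i → W (i + a) ≡ g (W i)) where

    W∘+na≡gⁿ∘W : ∀ n i → W (i + + n * a) ≡ (g ^ n) (W i)
    W∘+na≡gⁿ∘W zero    i = cong W (trans (cong (_+_ i) (*-zeroˡ a)) (+-identityʳ i))
    W∘+na≡gⁿ∘W (suc n) i =
      trans (cong W (i+[1+n]a≡i+na+a i (+ n) a))
            (trans (W∘+a≡g∘W _) (cong g (W∘+na≡gⁿ∘W n i)))
      where
      i+[1+n]a≡i+na+a : ∀ i n a → i + (+ 1 + n) * a ≡ i + n * a + a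
      i+[1+n]a≡i+na+a = solve-∀

    intertwining⇒HasIntPeriod : HasIntPeriod W (+ (k !) * a)
    intertwining⇒HasIntPeriod j = begin
      W (j + + (k !) * a)              ≡⟨ cong W (j-Ka+[K+F]a≡j+Fa j (+ k) (+ (k !)) a) ⟨
      W (j′ + + (k ℕ.+ k !) * a)       ≡⟨ W∘+na≡gⁿ∘W (k ℕ.+ k !) j′ ⟩
      (g ^ (k ℕ.+ k !)) (W j′)         ≡⟨ ^-[k+k!]≡^k (W j′) ⟩
      (g ^ k) (W j′)                   ≡⟨ W∘+na≡gⁿ∘W k j′ ⟨
      W (j′ + + k * a)                 ≡⟨ cong W (j-Ka+Ka≡j j (+ k) a) ⟩
      W j                              ∎
      where
      open ≡-Reasoning
      j′ : ℤ
      j′ = j - + k * a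
      j-Ka+[K+F]a≡j+Fa : ∀ j K F a → j - K * a + (K + F) * a ≡ j + F * a
      j-Ka+[K+F]a≡j+Fa = solve-∀
      j-Ka+Ka≡j : ∀ j K a → j - K * a + K * a ≡ j
      j-Ka+Ka≡j = solve-∀

IsColourSymmetry⇒colourMap : ∀ {k} (col : Strand → Fin k) t → IsColourSymmetry col t →
                             ∃[ g ] (∀ s → col (strandMap t s) ≡ g (col s))
IsColourSymmetry⇒colourMap col t symm =
  (λ c → proj₁ (symm c)) , λ s → proj₂ (symm (col s)) s refl

Periodic⇒horizontalTranslation : ∀ {F} → Periodic F →
                                 ∃[ a ] ∃[ b ] (a ≢ 0ℤ × InG₁ F (translation a b) e)
Periodic⇒horizontalTranslation (a , b , c , d , det≢0 , ab∈G₁ , cd∈G₁) with a ≟ 0ℤ | c ≟ 0ℤ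
... | no a≢0   | _        = a , b , a≢0 , ab∈G₁
... | yes _    | no c≢0   = c , d , c≢0 , cd∈G₁
... | yes refl | yes refl = ⊥-elim (det≢0 (cong (_-_ 0ℤ) (*-zeroʳ b)))

module _ {k : ℕ} (σ : Striping) (V H : ℤ → Fin k) where

  translationSymmetry⇒period : ∀ {a b} → a ≢ 0ℤ →
                               IsColourSymmetry (strandColour σ V H) (translation a b) →
                               ∃[ p ] (0 ℕ.< p × HasPeriod V p)
  translationSymmetry⇒period {a} {b} a≢0 symm
    with IsColourSymmetry⇒colourMap (strandColour σ V H) (translation a b) symm
  ... | g , commutes =
    p , 0<p , from (HasPeriod-stripes σ V p) (HasPeriod-*ℕ warpPeriod (width σ))
    where
    p : ℕ
    p = ℤ.∣ + (k !) * a ∣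
    warpPeriod : HasPeriod (λ i → V (stripeOf σ i)) p
    warpPeriod = HasIntPeriod⇒HasPeriod-∣∣ (intertwining⇒HasIntPeriod g (commutes ∘ warp))
    instance
      k!≢0 : NonZero (k !)
      k!≢0 = ℕ._!≢0 k
      ∣a∣≢0 : NonZero ℤ.∣ a ∣
      ∣a∣≢0 = ℕ.≢-nonZero (a≢0 ∘ ∣i∣≡0⇒i≡0)
    0<p : 0 ℕ.< p
    0<p = subst (0 ℕ.<_) (sym (abs-* (+ (k !)) a))
      (ℕ.>-nonZero⁻¹ (k ! ℕ.* ℤ.∣ a ∣) {{ℕ.m*n≢0 (k !) ℤ.∣ a ∣}})

  swapSymmetry⇒samePeriods : ∀ {n₁ n₂ c₁ c₂} →
                             IsColourSymmetry (strandColour σ V H) (iso true n₁ n₂ c₁ c₂) →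
                             ∀ p → HasPeriod V p ⇔ HasPeriod H p
  swapSymmetry⇒samePeriods {n₁} {n₂} {c₁} {c₂} symm p
    with IsColourSymmetry⇒colourMap (strandColour σ V H) (iso true n₁ n₂ c₁ c₂) symm
  ... | g , commutes =
    mk⇔ (transfer n₂ c₂ (commutes ∘ warp)) (transfer n₁ c₁ (commutes ∘ weft))
    where
    transfer : ∀ {X Y : ℤ → Fin k} n c →
               (∀ i → X (stripeOf σ (sgn n i + c)) ≡ g (Y (stripeOf σ i))) →
               HasPeriod Y p → HasPeriod X p
    transfer {X} {Y} n c X∘φ≡g∘Y =
      from (HasPeriod-stripes σ X p)
      ∘ HasIntPeriod-transport g n c X∘φ≡g∘Y
      ∘ to (HasPeriod-stripes σ Y p)

lemma4 : (F : Prefabric) → IsFabric F → Isonemal F →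
         (σ : Striping) (k : ℕ) (V H : ℤ → Fin k) →
         IsPerfect F (strandColour σ V H) →
         ∃[ p ] (IsPeriodOf V p × IsPeriodOf H p)
lemma4 F _ (periodic , transitive) σ k V H perfect
  with Periodic⇒horizontalTranslation periodic | transitive (warp 0ℤ) (weft 0ℤ)
... | _ , _ , a≢0 , a,b∈G₁ | iso true _ _ _ _ , r , t∈G₁ , _ =
  let P , 0<P , V-period = translationSymmetry⇒period σ V H a≢0 (perfect _ e a,b∈G₁)
      p , V-least        = leastPeriod Fin._≟_ {{ℕ.>-nonZero 0<P}} V-period
  in p , V-least , IsPeriodOf-cong (swapSymmetry⇒samePeriods σ V H (perfect _ r t∈G₁)) V-least
... | _ | iso false _ _ _ _ , _ , _ , ()
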